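{- If $u,v\in A^*$ satisfy $P(u)=P(v)$, then $u\cdot\gamma=v\cdot\gamma$ for every column $\gamma$; in particular $u\equiv_{plax}v$ implies $u\equiv_{styl}v$, so $\mathrm{Styl}(A)$ is a quotient of the plactic monoid.
   Context: $A$ is a finite totally ordered alphabet. $P(w)$ is the Schensted tableau of $w$, and $u\equiv_{plax}v$ iff $P(u)=P(v)$ (plactic congruence). A column is a subset of $A$, identified with the strictly decreasing word of its elements. For a column $\gamma$ and a letter $x$: if $x>y$ for all $y\in\gamma$, $x\cdot\gamma=\gamma\cup\{x\}$; otherwise with $y$ the smallest element of $\gamma$ with $y\geq x$, $x\cdot\gamma=(\gamma\setminus\{y\})\cup\{x\}$; this extends to a left action of $A^*$ on columns by $(uv)\cdot\gamma=u\cdot(v\cdot\gamma)$. $u\equiv_{styl}v$ iff $u\cdot\gamma=v\cdot\gamma$ for all columns $\gamma$, and $\mathrm{Styl}(A)=A^*/\equiv_{styl}$. -}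

module Defs where

open import Data.Nat using (ℕ)
open import Data.Fin using (Fin; _≤?_; _<?_)
open import Data.Fin.Subset using (Subset; inside; outside)
open import Data.Fin.Subset.Properties using (_∈?_)
open import Data.Vec using (_[_]≔_)
open import Data.List using (List; []; _∷_; filter; foldl; foldr; allFin)
open import Data.Maybe using (Maybe; just; nothing)
open import Data.Product using (_×_; _,_)
open import Relation.Nullary using (yes; no)
open import Relation.Nullary.Decidable using (_×-dec_)
open import Relation.Binary.PropositionalEquality using (_≡_)

Word : ℕ → Set
Word n = List (Fin n)

-- Schensted insertion (row bumping).
-- A row is a weakly increasing word; a tableau is the list of its rows,
-- from the first (bottom, longest) row upward.

Row : ℕ → Set
Row n = List (Fin n)

Tableau : ℕ → Set
Tableau n = List (Row n)

rowInsert : ∀ {n} → Fin n → Row n → Maybe (Fin n) × Row n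
rowInsert x [] = nothing , x ∷ []
rowInsert x (y ∷ r) with x <? y
... | yes _ = just y , x ∷ r
... | no _ with rowInsert x r
...   | b , r' = b , y ∷ r'

insert : ∀ {n} → Fin n → Tableau n → Tableau n
insert x [] = (x ∷ []) ∷ []
insert x (r ∷ t) with rowInsert x r
... | nothing , r' = r' ∷ t
... | just y , r' = r' ∷ insert y t

P : ∀ {n} → Word n → Tableau n
P w = foldl (λ t x → insert x t) [] w

_≡plax_ : ∀ {n} → Word n → Word n → Set
u ≡plax v = P u ≡ P v

Column : ℕ → Set
Column n = Subset n

-- smallest element y of γ with y ≥ x, if any (allFin n is increasing)
smallest≥ : ∀ {n} → Fin n → Column n → Maybe (Fin n)
smallest≥ {n} x γ with filter (λ y → (x ≤? y) ×-dec (y ∈? γ)) (allFin n)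
... | [] = nothing
... | y ∷ _ = just y

actLetter : ∀ {n} → Fin n → Column n → Column n
actLetter x γ with smallest≥ x γ
... | nothing = γ [ x ]≔ inside
... | just y = (γ [ y ]≔ outside) [ x ]≔ inside

act : ∀ {n} → Word n → Column n → Column n
act w γ = foldr actLetter γ w

_≡styl_ : ∀ {n} → Word n → Word n → Set
u ≡styl v = ∀ γ → act u γ ≡ act v γ

-- On a column, viewed as a bit vector, a letter acts by a simple structural recursion:
-- below x nothing changes, position x is switched on, and if x was absent the first
-- element above x is switched off.  In this form both Knuth relations
-- acb ≡ cab (a ≤ b < c) and bac ≡ bca (a < b ≤ c) are checked by a short induction.
-- Since the action is a left action, ≡styl is a congruence, and every Schensted row
-- insertion rewrites the reading word of T followed by x into the reading word of the
-- new tableau by Knuth moves.  Hence every word is ≡styl to the reading word of P(w).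
module Submission where

open import Defs
open import Data.Nat using (ℕ)
import Data.Nat as ℕ
import Data.Nat.Properties as ℕ
open import Data.Bool using (true; false; _∧_)
open import Data.Fin using (Fin; zero; suc; _≤?_; _<?_; _≤_; _<_)
open import Data.Fin.Subset using (Subset; inside; outside)
open import Data.Fin.Subset.Properties using (_∈?_)
open import Data.Vec using ([]; _∷_; _[_]≔_)
open import Data.List using ([]; _∷_; _++_; [_]; map; filter; tabulate; allFin; head; foldr; foldl)
open import Data.List.Properties using (map-tabulate; head-map; foldr-cong; foldr-++; ++-assoc; ++-identityʳ)
open import Data.List.Relation.Unary.All as All using (All; []; _∷_)
import Data.List.Relation.Unary.All.Properties as All
open import Data.List.Relation.Unary.AllPairs using (AllPairs; []; _∷_)
import Data.List.Relation.Unary.AllPairs.Properties as AllPairs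
open import Data.Maybe using (Maybe; just; nothing; maybe)
import Data.Maybe as Maybe
open import Data.Product using (_×_; _,_)
open import Function using (_∘_; id; mk⇔)
open import Level using (0ℓ)
open import Relation.Nullary using (yes; no; does)
open import Relation.Nullary.Decidable using (_×-dec_; does-⇔)
open import Relation.Unary using (Pred; Decidable)
open import Relation.Binary using (Setoid)
open import Relation.Binary.PropositionalEquality
  using (_≡_; refl; sym; trans; cong; _≗_; module ≡-Reasoning)
import Relation.Binary.Reasoning.Setoid as ≈-Reasoning

dropMin : ∀ {n} → Subset n → Subset n
dropMin []          = []
dropMin (true  ∷ γ) = false ∷ γ
dropMin (false ∷ γ) = false ∷ dropMin γ

act₁ : ∀ {n} → Fin n → Subset n → Subset n
act₁ zero    (true  ∷ γ) = true ∷ γ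
act₁ zero    (false ∷ γ) = true ∷ dropMin γ
act₁ (suc x) (b ∷ γ)     = b ∷ act₁ x γ

filter-map-does : ∀ {A B : Set} {P : Pred B 0ℓ} {Q : Pred A 0ℓ}
                  (P? : Decidable P) (Q? : Decidable Q) (f : A → B) →
                  (∀ x → does (P? (f x)) ≡ does (Q? x)) →
                  filter P? ∘ map f ≗ map f ∘ filter Q?
filter-map-does P? Q? f eq [] = refl
filter-map-does P? Q? f eq (x ∷ xs) with does (P? (f x)) | does (Q? x) | eq x
... | true  | true  | refl = cong (f x ∷_) (filter-map-does P? Q? f eq xs)
... | false | false | refl = filter-map-does P? Q? f eq xs

smallest≥≡head : ∀ {n} (x : Fin n) (γ : Subset n) →
                 smallest≥ x γ ≡ head (filter (λ y → (x ≤? y) ×-dec (y ∈? γ)) (allFin n))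
smallest≥≡head {n} x γ with filter (λ y → (x ≤? y) ×-dec (y ∈? γ)) (allFin n)
... | []    = refl
... | _ ∷ _ = refl

-- allFin (suc n) is definitionally zero ∷ tabulate suc.
head-filter-tabulate-suc : ∀ {n} {P : Pred (Fin (ℕ.suc n)) 0ℓ} {Q : Pred (Fin n) 0ℓ}
                 (P? : Decidable P) (Q? : Decidable Q) →
                 (∀ y → does (P? (suc y)) ≡ does (Q? y)) →
                 head (filter P? (tabulate suc)) ≡ Maybe.map suc (head (filter Q? (allFin n)))
head-filter-tabulate-suc {n} P? Q? eq = begin
  head (filter P? (tabulate suc))               ≡⟨ cong (head ∘ filter P?) (sym (map-tabulate id suc)) ⟩
  head (filter P? (map suc (allFin n)))         ≡⟨ cong head (filter-map-does P? Q? suc eq (allFin n)) ⟩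
  head (map suc (filter Q? (allFin n)))         ≡⟨ head-map _ ⟩
  Maybe.map suc (head (filter Q? (allFin n)))   ∎
  where open ≡-Reasoning

smallest≥-zero-false : ∀ {n} (γ : Subset (ℕ.suc n)) →
                       smallest≥ zero (false ∷ γ) ≡ Maybe.map suc (smallest≥ zero γ)
smallest≥-zero-false {n} γ =
  trans (smallest≥≡head zero (false ∷ γ))
        (trans (head-filter-tabulate-suc (λ y → (zero {ℕ.suc n} ≤? y) ×-dec (y ∈? (false ∷ γ)))
                               (λ y → (zero {n} ≤? y) ×-dec (y ∈? γ))
                               (λ _ → refl))
               (cong (Maybe.map suc) (sym (smallest≥≡head zero γ))))

smallest≥-suc : ∀ {n} (x : Fin n) b (γ : Subset n) →
                smallest≥ (suc x) (b ∷ γ) ≡ Maybe.map suc (smallest≥ x γ)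
smallest≥-suc x b γ =
  trans (smallest≥≡head (suc x) (b ∷ γ))
        (trans (head-filter-tabulate-suc (λ y → (suc x ≤? y) ×-dec (y ∈? (b ∷ γ))) (λ y → (x ≤? y) ×-dec (y ∈? γ))
                               suc≤?suc)
               (cong (Maybe.map suc) (sym (smallest≥≡head x γ))))
  where
  suc≤?suc : ∀ y → does ((suc x ≤? suc y) ×-dec (suc y ∈? (b ∷ γ))) ≡ does ((x ≤? y) ×-dec (y ∈? γ))
  suc≤?suc y = cong (_∧ does (y ∈? γ)) (does-⇔ (mk⇔ ℕ.s≤s⁻¹ ℕ.s≤s) (suc x ≤? suc y) (x ≤? y))

remove : ∀ {n} → Subset n → Maybe (Fin n) → Subset n
remove γ = maybe (γ [_]≔ outside) γ

remove-suc : ∀ {n} b (γ : Subset n) m → remove (b ∷ γ) (Maybe.map suc m) ≡ b ∷ remove γ m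
remove-suc b γ nothing  = refl
remove-suc b γ (just _) = refl

actLetter≡remove-smallest≥ : ∀ {n} (x : Fin n) (γ : Subset n) →
                             actLetter x γ ≡ remove γ (smallest≥ x γ) [ x ]≔ inside
actLetter≡remove-smallest≥ x γ with smallest≥ x γ
... | nothing = refl
... | just _  = refl

false∷dropMin≡remove : ∀ {n} (γ : Subset n) → false ∷ dropMin γ ≡ remove (false ∷ γ) (smallest≥ zero (false ∷ γ))
false∷dropMin≡remove []          = refl
false∷dropMin≡remove (true ∷ γ)  = refl
false∷dropMin≡remove (false ∷ γ) = begin
  false ∷ false ∷ dropMin γ
    ≡⟨ cong (false ∷_) (false∷dropMin≡remove γ) ⟩
  false ∷ remove (false ∷ γ) (smallest≥ zero (false ∷ γ))
    ≡⟨ sym (remove-suc false (false ∷ γ) (smallest≥ zero (false ∷ γ))) ⟩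
  remove (false ∷ false ∷ γ) (Maybe.map suc (smallest≥ zero (false ∷ γ)))
    ≡⟨ cong (remove (false ∷ false ∷ γ)) (sym (smallest≥-zero-false (false ∷ γ))) ⟩
  remove (false ∷ false ∷ γ) (smallest≥ zero (false ∷ false ∷ γ)) ∎
  where open ≡-Reasoning

actLetter≗act₁ : ∀ {n} (x : Fin n) → actLetter x ≗ act₁ x
actLetter≗act₁ x γ = trans (actLetter≡remove-smallest≥ x γ) (remove-smallest≥≡act₁ x γ)
  where
  remove-smallest≥≡act₁ : ∀ {n} (x : Fin n) (γ : Subset n) →
                          remove γ (smallest≥ x γ) [ x ]≔ inside ≡ act₁ x γ
  remove-smallest≥≡act₁ zero    (true ∷ γ)  = refl
  remove-smallest≥≡act₁ zero    (false ∷ γ) = cong (_[ zero ]≔ inside) (sym (false∷dropMin≡remove γ))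
  remove-smallest≥≡act₁ (suc x) (b ∷ γ)     = begin
    remove (b ∷ γ) (smallest≥ (suc x) (b ∷ γ)) [ suc x ]≔ inside
      ≡⟨ cong (λ m → remove (b ∷ γ) m [ suc x ]≔ inside) (smallest≥-suc x b γ) ⟩
    remove (b ∷ γ) (Maybe.map suc (smallest≥ x γ)) [ suc x ]≔ inside
      ≡⟨ cong (_[ suc x ]≔ inside) (remove-suc b γ (smallest≥ x γ)) ⟩
    b ∷ remove γ (smallest≥ x γ) [ x ]≔ inside
      ≡⟨ cong (b ∷_) (remove-smallest≥≡act₁ x γ) ⟩
    b ∷ act₁ x γ ∎
    where open ≡-Reasoning

dropMin-act₁-act₁ : ∀ {n} {b c : Fin n} → b < c → ∀ γ →
                    dropMin (act₁ c (act₁ b γ)) ≡ act₁ c (dropMin (act₁ b γ))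
dropMin-act₁-act₁ {b = zero}  {suc c} _           (true  ∷ γ) = refl
dropMin-act₁-act₁ {b = zero}  {suc c} _           (false ∷ γ) = refl
dropMin-act₁-act₁ {b = suc b} {suc c} _           (true  ∷ γ) = refl
dropMin-act₁-act₁ {b = suc b} {suc c} (ℕ.s≤s b<c) (false ∷ γ) = cong (false ∷_) (dropMin-act₁-act₁ b<c γ)

dropMin²-act₁ : ∀ {n} (c : Fin n) γ → dropMin (dropMin (act₁ c γ)) ≡ dropMin (act₁ c (dropMin γ))
dropMin²-act₁ zero    (true  ∷ γ) = refl
dropMin²-act₁ zero    (false ∷ γ) = refl
dropMin²-act₁ (suc c) (true  ∷ γ) = refl
dropMin²-act₁ (suc c) (false ∷ γ) = cong (false ∷_) (dropMin²-act₁ c γ)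

act₁-dropMin-act₁ : ∀ {n} {b c : Fin n} → b ≤ c → ∀ γ →
                    act₁ b (dropMin (act₁ c γ)) ≡ act₁ b (act₁ c (dropMin γ))
act₁-dropMin-act₁ {b = zero}  {zero}  _           (true  ∷ γ) = refl
act₁-dropMin-act₁ {b = zero}  {zero}  _           (false ∷ γ) = refl
act₁-dropMin-act₁ {b = zero}  {suc c} _           (true  ∷ γ) = refl
act₁-dropMin-act₁ {b = zero}  {suc c} _           (false ∷ γ) = cong (true ∷_) (dropMin²-act₁ c γ)
act₁-dropMin-act₁ {b = suc b} {suc c} _           (true  ∷ γ) = refl
act₁-dropMin-act₁ {b = suc b} {suc c} (ℕ.s≤s b≤c) (false ∷ γ) = cong (false ∷_) (act₁-dropMin-act₁ b≤c γ)

act₁-knuth₁ : ∀ {n} (a b c : Fin n) → a ≤ b → b < c → ∀ γ →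
              act₁ a (act₁ c (act₁ b γ)) ≡ act₁ c (act₁ a (act₁ b γ))
act₁-knuth₁ (suc a) (suc b) (suc c) (ℕ.s≤s a≤b) (ℕ.s≤s b<c) (g ∷ γ) = cong (g ∷_) (act₁-knuth₁ a b c a≤b b<c γ)
act₁-knuth₁ zero    zero    (suc c) _ _           (true  ∷ γ) = refl
act₁-knuth₁ zero    zero    (suc c) _ _           (false ∷ γ) = refl
act₁-knuth₁ zero    (suc b) (suc c) _ _           (true  ∷ γ) = refl
act₁-knuth₁ zero    (suc b) (suc c) _ (ℕ.s≤s b<c) (false ∷ γ) = cong (true ∷_) (dropMin-act₁-act₁ b<c γ)

act₁-knuth₂ : ∀ {n} (a b c : Fin n) → a < b → b ≤ c → ∀ γ →
              act₁ b (act₁ a (act₁ c γ)) ≡ act₁ b (act₁ c (act₁ a γ))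
act₁-knuth₂ (suc a) (suc b) (suc c) (ℕ.s≤s a<b) (ℕ.s≤s b≤c) (g ∷ γ) = cong (g ∷_) (act₁-knuth₂ a b c a<b b≤c γ)
act₁-knuth₂ zero    (suc b) (suc c) _ _           (true  ∷ γ) = refl
act₁-knuth₂ zero    (suc b) (suc c) _ (ℕ.s≤s b≤c) (false ∷ γ) = cong (true ∷_) (act₁-dropMin-act₁ b≤c γ)

act₁* : ∀ {n} → Word n → Subset n → Subset n
act₁* w γ = foldr act₁ γ w

act≗act₁* : ∀ {n} (w : Word n) → act w ≗ act₁* w
act≗act₁* w γ = foldr-cong actLetter≗act₁ refl w

-- This keeps type checking tractable: act₁ is stuck on a
-- neutral column, whereas actLetter unfolds into the filter defining smallest≥; and as
-- a record the relation determines u and v, so they can be inferred from a proof.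
record _≈styl_ {n} (u v : Word n) : Set where
  constructor styl
  field act₁*-≗ : act₁* u ≗ act₁* v
open _≈styl_

≈styl⇒≡styl : ∀ {n} {u v : Word n} → u ≈styl v → u ≡styl v
≈styl⇒≡styl {u = u} {v} u≈v γ = begin
  act u γ    ≡⟨ act≗act₁* u γ ⟩
  act₁* u γ  ≡⟨ act₁*-≗ u≈v γ ⟩
  act₁* v γ  ≡⟨ act≗act₁* v γ ⟨
  act v γ    ∎
  where open ≡-Reasoning

act₁*-++ : ∀ {n} (u v : Word n) γ → act₁* (u ++ v) γ ≡ act₁* u (act₁* v γ)
act₁*-++ u v γ = foldr-++ act₁ γ u v

≈styl-setoid : ℕ → Setoid 0ℓ 0ℓ
≈styl-setoid n = record
  { Carrier       = Word n
  ; _≈_           = _≈styl_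
  ; isEquivalence = record
    { refl  = styl λ _ → refl
    ; sym   = λ u≈v → styl λ γ → sym (act₁*-≗ u≈v γ)
    ; trans = λ u≈v v≈w → styl λ γ → trans (act₁*-≗ u≈v γ) (act₁*-≗ v≈w γ)
    }
  }

++-congˡ-styl : ∀ {n} (w : Word n) {u v : Word n} → u ≈styl v → (w ++ u) ≈styl (w ++ v)
++-congˡ-styl w {u} {v} u≈v = styl λ γ → begin
  act₁* (w ++ u) γ     ≡⟨ act₁*-++ w u γ ⟩
  act₁* w (act₁* u γ)  ≡⟨ cong (act₁* w) (act₁*-≗ u≈v γ) ⟩
  act₁* w (act₁* v γ)  ≡⟨ act₁*-++ w v γ ⟨
  act₁* (w ++ v) γ     ∎
  where open ≡-Reasoning

++-congʳ-styl : ∀ {n} (w : Word n) {u v : Word n} → u ≈styl v → (u ++ w) ≈styl (v ++ w)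
++-congʳ-styl w {u} {v} u≈v = styl λ γ → begin
  act₁* (u ++ w) γ     ≡⟨ act₁*-++ u w γ ⟩
  act₁* u (act₁* w γ)  ≡⟨ act₁*-≗ u≈v (act₁* w γ) ⟩
  act₁* v (act₁* w γ)  ≡⟨ act₁*-++ v w γ ⟨
  act₁* (v ++ w) γ     ∎
  where open ≡-Reasoning

knuth₁ : ∀ {n} (a b c : Fin n) → a ≤ b → b < c → (a ∷ c ∷ b ∷ []) ≈styl (c ∷ a ∷ b ∷ [])
knuth₁ a b c a≤b b<c = styl (act₁-knuth₁ a b c a≤b b<c)

knuth₂ : ∀ {n} (a b c : Fin n) → a < b → b ≤ c → (b ∷ a ∷ c ∷ []) ≈styl (b ∷ c ∷ a ∷ [])
knuth₂ a b c a<b b≤c = styl (act₁-knuth₂ a b c a<b b≤c)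

slideʳ : ∀ {n} (x z : Fin n) {q : Row n} → x < z → All (z ≤_) q → AllPairs _≤_ q →
         (z ∷ x ∷ q) ≈styl (z ∷ q ++ [ x ])
slideʳ x z {[]}    _   _         _                = styl λ _ → refl
slideʳ x z {c ∷ q} x<z (z≤c ∷ _) (c≤q ∷ q-sorted) = begin
  z ∷ x ∷ c ∷ q       ≈⟨ ++-congʳ-styl q (knuth₂ x z c x<z z≤c) ⟩
  z ∷ c ∷ x ∷ q       ≈⟨ ++-congˡ-styl [ z ] (slideʳ x c (ℕ.<-≤-trans x<z z≤c) c≤q q-sorted) ⟩
  z ∷ c ∷ q ++ [ x ]  ∎
  where open ≈-Reasoning (≈styl-setoid _)

slideˡ : ∀ {n} (x y : Fin n) {p : Row n} → AllPairs _≤_ p → All (_≤ x) p → x < y →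
         (p ++ y ∷ x ∷ []) ≈styl (y ∷ p ++ [ x ])
slideˡ x y {[]}        _ _ _ = styl λ _ → refl
slideˡ x y {a ∷ []}    _ (a≤x ∷ []) x<y = knuth₁ a x y a≤x x<y
slideˡ x y {a ∷ b ∷ p} ((a≤b ∷ _) ∷ p-sorted) (_ ∷ b≤x ∷ p≤x) x<y = begin
  a ∷ b ∷ p ++ y ∷ x ∷ []  ≈⟨ ++-congˡ-styl [ a ] (slideˡ x y p-sorted (b≤x ∷ p≤x) x<y) ⟩
  a ∷ y ∷ b ∷ p ++ [ x ]   ≈⟨ ++-congʳ-styl (p ++ [ x ]) (knuth₁ a b y a≤b (ℕ.≤-<-trans b≤x x<y)) ⟩
  y ∷ a ∷ b ∷ p ++ [ x ]   ∎
  where open ≈-Reasoning (≈styl-setoid _)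

bump-styl : ∀ {n} (x y : Fin n) {p q : Row n} → AllPairs _≤_ p → All (_≤ x) p → x < y →
            All (y ≤_) q → AllPairs _≤_ q → (y ∷ p ++ x ∷ q) ≈styl ((p ++ y ∷ q) ++ [ x ])
bump-styl x y {p} {q} p-sorted p≤x x<y y≤q q-sorted = begin
  y ∷ p ++ x ∷ q          ≡⟨ cong (y ∷_) (++-assoc p [ x ] q) ⟨
  (y ∷ p ++ [ x ]) ++ q   ≈⟨ ++-congʳ-styl q (slideˡ x y p-sorted p≤x x<y) ⟨
  (p ++ y ∷ x ∷ []) ++ q  ≡⟨ ++-assoc p (y ∷ x ∷ []) q ⟩
  p ++ y ∷ x ∷ q          ≈⟨ ++-congˡ-styl p (slideʳ x y x<y y≤q q-sorted) ⟩
  p ++ y ∷ q ++ [ x ]     ≡⟨ ++-assoc p (y ∷ q) [ x ] ⟨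
  (p ++ y ∷ q) ++ [ x ]   ∎
  where open ≈-Reasoning (≈styl-setoid _)

data RowInsertion {n} (x : Fin n) (r : Row n) : Maybe (Fin n) × Row n → Set where
  appended : All (_≤ x) r → RowInsertion x r (nothing , r ++ [ x ])
  bumped   : ∀ p {y} q → r ≡ p ++ y ∷ q → All (_≤ x) p → x < y → RowInsertion x r (just y , p ++ x ∷ q)

rowInsert-spec : ∀ {n} (x : Fin n) (r : Row n) → RowInsertion x r (rowInsert x r)
rowInsert-spec x []      = appended []
rowInsert-spec x (y ∷ r) with x <? y
... | yes x<y = bumped [] r refl [] x<y
... | no  x≮y with rowInsert x r | rowInsert-spec x r
...   | _ | appended r≤x              = appended (ℕ.≮⇒≥ x≮y ∷ r≤x)
...   | _ | bumped p q refl p≤x x<y′ = bumped (y ∷ p) q refl (ℕ.≮⇒≥ x≮y ∷ p≤x) x<y′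

sorted-++-∷ : ∀ {n} {x : Fin n} {p q : Row n} → AllPairs _≤_ p → All (_≤ x) p →
              All (x ≤_) q → AllPairs _≤_ q → AllPairs _≤_ (p ++ x ∷ q)
sorted-++-∷ p-sorted p≤x x≤q q-sorted =
  AllPairs.++⁺ p-sorted (x≤q ∷ q-sorted) (All.map (λ a≤x → a≤x ∷ All.map (ℕ.≤-trans a≤x) x≤q) p≤x)

sorted-++-∷⁻ : ∀ {n} (p : Row n) {y : Fin n} {q : Row n} → AllPairs _≤_ (p ++ y ∷ q) →
               AllPairs _≤_ p × All (y ≤_) q × AllPairs _≤_ q
sorted-++-∷⁻ []      (y≤q ∷ q-sorted) = [] , y≤q , q-sorted
sorted-++-∷⁻ (a ∷ p) (a≤ ∷ sorted) with sorted-++-∷⁻ p sorted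
... | p-sorted , y≤q , q-sorted = All.++⁻ˡ p a≤ ∷ p-sorted , y≤q , q-sorted

insert-rows-sorted : ∀ {n} (x : Fin n) {T : Tableau n} → All (AllPairs _≤_) T → All (AllPairs _≤_) (insert x T)
insert-rows-sorted x {[]}    _ = ([] ∷ []) ∷ []
insert-rows-sorted x {r ∷ t} (r-sorted ∷ t-sorted) with rowInsert x r | rowInsert-spec x r
... | _ | appended r≤x = sorted-++-∷ r-sorted r≤x [] [] ∷ t-sorted
... | _ | bumped p q refl p≤x x<y with sorted-++-∷⁻ p r-sorted
...   | p-sorted , y≤q , q-sorted =
  sorted-++-∷ p-sorted p≤x (All.map (ℕ.<⇒≤ ∘ ℕ.<-≤-trans x<y) y≤q) q-sorted ∷ insert-rows-sorted _ t-sorted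

reading : ∀ {n} → Tableau n → Word n
reading []      = []
reading (r ∷ t) = reading t ++ r

reading-insert : ∀ {n} (x : Fin n) {T : Tableau n} → All (AllPairs _≤_) T →
                 reading (insert x T) ≈styl (reading T ++ [ x ])
reading-insert x {[]}    _ = styl λ _ → refl
reading-insert x {r ∷ t} (r-sorted ∷ t-sorted) with rowInsert x r | rowInsert-spec x r
... | _ | appended _ = Setoid.reflexive (≈styl-setoid _) (sym (++-assoc (reading t) r [ x ]))
... | _ | bumped p {y} q refl p≤x x<y with sorted-++-∷⁻ p r-sorted
...   | p-sorted , y≤q , q-sorted = begin
  reading (insert y t) ++ p ++ x ∷ q   ≈⟨ ++-congʳ-styl (p ++ x ∷ q) (reading-insert y t-sorted) ⟩
  (reading t ++ [ y ]) ++ p ++ x ∷ q   ≡⟨ ++-assoc (reading t) [ y ] (p ++ x ∷ q) ⟩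
  reading t ++ y ∷ p ++ x ∷ q          ≈⟨ ++-congˡ-styl (reading t) (bump-styl x y p-sorted p≤x x<y y≤q q-sorted) ⟩
  reading t ++ (p ++ y ∷ q) ++ [ x ]   ≡⟨ ++-assoc (reading t) (p ++ y ∷ q) [ x ] ⟨
  (reading t ++ p ++ y ∷ q) ++ [ x ]   ∎
  where open ≈-Reasoning (≈styl-setoid _)

reading-foldl-insert : ∀ {n} {T : Tableau n} → All (AllPairs _≤_) T → ∀ w →
                       reading (foldl (λ t x → insert x t) T w) ≈styl (reading T ++ w)
reading-foldl-insert {T = T} _ [] = Setoid.reflexive (≈styl-setoid _) (sym (++-identityʳ (reading T)))
reading-foldl-insert {T = T} T-sorted (x ∷ w) = begin
  reading (foldl (λ t x → insert x t) (insert x T) w)  ≈⟨ reading-foldl-insert (insert-rows-sorted x T-sorted) w ⟩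
  reading (insert x T) ++ w                            ≈⟨ ++-congʳ-styl w (reading-insert x T-sorted) ⟩
  (reading T ++ [ x ]) ++ w                            ≡⟨ ++-assoc (reading T) [ x ] w ⟩
  reading T ++ x ∷ w                                   ∎
  where open ≈-Reasoning (≈styl-setoid _)

reading-P : ∀ {n} (w : Word n) → reading (P w) ≈styl w
reading-P = reading-foldl-insert []

proposition5p1 : (n : ℕ) (u v : Word n) → u ≡plax v → u ≡styl v
proposition5p1 n u v P[u]≡P[v] = ≈styl⇒≡styl (begin
  u              ≈⟨ reading-P u ⟨
  reading (P u)  ≡⟨ cong reading P[u]≡P[v] ⟩
  reading (P v)  ≈⟨ reading-P v ⟩
  v              ∎)
  where open ≈-Reasoning (≈styl-setoid n)
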